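{- Let $\mathbb{K}=(G,M,I,\preceq)$ be an extended formal context and $A,B\subseteq M$ with $\mathbb{K}\models A\rightsquigarrow B$. Then $\underline{A'}=\underline{(A\cup B)'}$.
   Context: An extended formal context is $(G,M,I,\preceq)$ with $G$ a finite non-empty set of objects, $M$ a finite non-empty set of attributes, $I\subseteq G\times M$, and $\preceq$ a partial order on $G$ with strict part $\prec$. For $B\subseteq M$, $B'=\{g\in G\mid\forall m\in B,\ (g,m)\in I\}$, and the minimised derivation is $\underline{B'}=\{g\in B'\mid\nexists h\in B'\text{ with } h\prec g\}$. $\mathbb{K}\models A\rightsquigarrow B$ means $\underline{A'}\subseteq B'$. -}

module Defs where

open import Level using (0ℓ; suc)
open import Data.Nat using (ℕ; NonZero)
open import Data.Fin using (Fin)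
open import Data.Product using (_×_; ∃)
open import Relation.Nullary using (¬_)
open import Relation.Unary using (Pred; _∈_; _⊆_; _∪_)
open import Relation.Binary using (Rel; IsPartialOrder)
open import Relation.Binary.PropositionalEquality using (_≡_; _≢_)

record ExtContext : Set₁ where
  field
    nG : ℕ
    nM : ℕ
    .{{nG≢0}} : NonZero nG
    .{{nM≢0}} : NonZero nM
    I   : Fin nG → Fin nM → Set
    _⪯_ : Rel (Fin nG) 0ℓ
    isPartialOrder : IsPartialOrder _≡_ _⪯_

  G : Set
  G = Fin nG

  M : Set
  M = Fin nM

  _≺_ : G → G → Set
  h ≺ g = h ⪯ g × h ≢ g

  _′ : Pred M 0ℓ → Pred G 0ℓ
  (B ′) g = ∀ m → m ∈ B → I g m

  min′ : Pred M 0ℓ → Pred G 0ℓ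
  min′ B g = g ∈ (B ′) × ¬ ∃ (λ h → h ∈ (B ′) × h ≺ g)

  _⇝_ : Pred M 0ℓ → Pred M 0ℓ → Set
  A ⇝ B = min′ A ⊆ (B ′)

_≐_ : {A : Set} → Pred A 0ℓ → Pred A 0ℓ → Set
P ≐ Q = (P ⊆ Q) × (Q ⊆ P)

-- Since the strict order on a finite set is well-founded, every object of A′ lying below g
-- would lie above a minimal one; that one is in B′ because A ⇝ B, hence in (A ∪ B)′, which
-- rules it out below a minimal element g of (A ∪ B)′.
module Submission where

open import Defs
open import Level using (0ℓ)
open import Data.Fin.Induction using (po-wellFounded)
open import Data.Product using (_×_; _,_; ∃; proj₁)
open import Data.Sum using (inj₁; inj₂)
open import Induction.WellFounded using (WellFounded; Acc; acc)
open import Relation.Binary using (Rel; Transitive)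
open import Relation.Binary.PropositionalEquality using (_≡_)
open import Relation.Nullary using (¬_)
open import Relation.Unary using (Pred; _∪_; _∩_; _⊆_)
import Relation.Binary.Construct.NonStrictToStrict as ToStrict

module _ {X : Set} (_<_ : Rel X 0ℓ) where

  Minimal : Pred X 0ℓ → Pred X 0ℓ
  Minimal P x = P x × ¬ ∃ λ y → P y × y < x

  Minimal-restrict : ∀ {P Q : Pred X 0ℓ} → Q ⊆ P → Minimal P ∩ Q ⊆ Minimal Q
  Minimal-restrict Q⊆P ((_ , x-min) , Qx) = Qx , λ (y , Qy , y<x) → x-min (y , Q⊆P Qy , y<x)

  module _ (wf : WellFounded _<_) (<-trans : Transitive _<_) where

    Minimal-extend : ∀ {P Q : Pred X 0ℓ} → Q ⊆ P → Minimal P ⊆ Q → Minimal Q ⊆ Minimal P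
    Minimal-extend {P} {Q} Q⊆P minP⊆Q {x} (Qx , x-min) =
      Q⊆P Qx , λ (y , Py , y<x) → nothing-below (wf y) Py y<x
      where
      -- Induction on y: everything of P below y is excluded, so y itself is minimal in P.
      nothing-below : ∀ {y} → Acc _<_ y → P y → ¬ (y < x)
      nothing-below {y} (acc rec) Py y<x = x-min (y , minP⊆Q (Py , y-min) , y<x)
        where
        y-min : ¬ ∃ λ z → P z × z < y
        y-min (z , Pz , z<y) = nothing-below (rec z<y) Pz (<-trans z<y y<x)

    Minimal-≐ : ∀ {P Q : Pred X 0ℓ} → Q ⊆ P → Minimal P ⊆ Q → Minimal P ≐ Minimal Q
    Minimal-≐ Q⊆P minP⊆Q =
      (λ minP → Minimal-restrict Q⊆P (minP , minP⊆Q minP)) , Minimal-extend Q⊆P minP⊆Q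

module _ (K : ExtContext) where
  open ExtContext K

  ≺-wellFounded : WellFounded _≺_
  ≺-wellFounded = po-wellFounded isPartialOrder

  ≺-trans : Transitive _≺_
  ≺-trans = ToStrict.<-trans _≡_ _⪯_ isPartialOrder

  ′-antitone : ∀ {A B : Pred M 0ℓ} → A ⊆ B → B ′ ⊆ A ′
  ′-antitone A⊆B g∈B′ m m∈A = g∈B′ m (A⊆B m∈A)

  ′-∪⁺ : ∀ {A B : Pred M 0ℓ} → A ′ ∩ B ′ ⊆ (A ∪ B) ′
  ′-∪⁺ (g∈A′ , g∈B′) m (inj₁ m∈A) = g∈A′ m m∈A
  ′-∪⁺ (g∈A′ , g∈B′) m (inj₂ m∈B) = g∈B′ m m∈B

lemma2 : (K : ExtContext) → let open ExtContext K in
    (A B : Pred M 0ℓ) → A ⇝ B → min′ A ≐ min′ (A ∪ B)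
lemma2 K A B A⇝B =
  Minimal-≐ _≺_ (≺-wellFounded K) (≺-trans K) (′-antitone K inj₁)
    (λ g∈minA′ → ′-∪⁺ K (proj₁ g∈minA′ , A⇝B g∈minA′))
  where open ExtContext K
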